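{- Let $G$ and $H$ be graphs (i.e., $2$-uniform hypergraphs). If $G\equiv H$, then $G\cong_f H$.
   Context: All graphs are finite, simple. For a graph $G$ with vertices $v_1,\dots,v_n$, its adjacency matrix $A_G\in\{0,1\}^{n\times n}$ has $A_G(i,j)=1$ iff $v_iv_j\in E(G)$. A doubly stochastic matrix is a square matrix with nonnegative entries whose rows and columns each sum to $1$. Graphs $G$ and $H$ are fractionally isomorphic, written $G\cong_f H$, if there is a doubly stochastic matrix $S$ with $A_G S=S A_H$. A hypergraph $G=(V,X)$ consists of a finite vertex set $V$ and a family $X$ of subsets of $V$ (hyperedges). If $G$ has $n$ vertices and $m\ge1$ hyperedges, its vertex-hyperedge incidence matrix $M_G\in\{0,1\}^{n\times m}$ has $(i,j)$ entry $1$ iff vertex $i$ belongs to hyperedge $j$. For hypergraphs $G,H$, write $G\equiv H$ if either $G$ and $H$ have the same number of vertices and no hyperedges, or there exist doubly stochastic matrices $S_1,S_2$ with $S_1M_G=M_HS_2^t$ and $M_GS_2=S_1^tM_H$.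
   Formalization: The doubly stochastic matrices $S_1,S_2$ in $G\equiv H$ and the matrix $S$ in $G\cong_f H$ have rational entries. -}

module Defs where

open import Data.Nat using (ℕ; zero; suc; _≤_)
open import Data.Fin using (Fin; _≟_)
open import Data.Fin.Properties using (any?)
open import Data.Product using (_×_; _,_; proj₁; proj₂; Σ)
open import Data.Sum using (_⊎_; inj₁; inj₂)
open import Data.Bool using (Bool; true; false; if_then_else_; _∨_)
open import Data.Rational using (ℚ; 0ℚ; 1ℚ; _+_; _*_) renaming (_≤_ to _≤ℚ_)
open import Relation.Binary.PropositionalEquality using (_≡_; _≢_)
open import Relation.Nullary using (Dec; yes; no; ¬_)
open import Relation.Nullary.Decidable using (⌊_⌋; _×-dec_; _⊎-dec_)

Matrix : ℕ → ℕ → Set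
Matrix r c = Fin r → Fin c → ℚ

∑ : (n : ℕ) → (Fin n → ℚ) → ℚ
∑ zero    f = 0ℚ
∑ (suc n) f = f Fin.zero + ∑ n (λ i → f (Fin.suc i))

_⊗_ : ∀ {r k c} → Matrix r k → Matrix k c → Matrix r c
_⊗_ {k = k} A B i j = ∑ k (λ l → A i l * B l j)

transpose : ∀ {r c} → Matrix r c → Matrix c r
transpose A i j = A j i

_≐_ : ∀ {r c} → Matrix r c → Matrix r c → Set
A ≐ B = ∀ i j → A i j ≡ B i j

-- Doubly stochastic: nonnegative entries, every row and every column sums to 1.
-- (Stated for r×c matrices; these conditions force r = c whenever such a
-- matrix exists, since the total sum equals both r and c.)
DoublyStochastic : ∀ {r c} → Matrix r c → Set
DoublyStochastic {r} {c} S =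
  (∀ i j → 0ℚ ≤ℚ S i j) ×
  (∀ i → ∑ c (λ j → S i j) ≡ 1ℚ) ×
  (∀ j → ∑ r (λ i → S i j) ≡ 1ℚ)

SameEdge : ∀ {n} → Fin n × Fin n → Fin n × Fin n → Set
SameEdge (a , b) (c , d) = (a ≡ c × b ≡ d) ⊎ (a ≡ d × b ≡ c)

sameEdge? : ∀ {n} (p q : Fin n × Fin n) → Dec (SameEdge p q)
sameEdge? (a , b) (c , d) = ((a ≟ c) ×-dec (b ≟ d)) ⊎-dec ((a ≟ d) ×-dec (b ≟ c))

-- A finite simple graph, viewed as a 2-uniform hypergraph:
-- vertices Fin n, hyperedges indexed by Fin m, hyperedge k = {ends k}
-- (a 2-element set, by looplessness); distinct indices give distinct edges.
record Graph : Set where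
  field
    n        : ℕ
    m        : ℕ
    ends     : Fin m → Fin n × Fin n
    loopless : ∀ k → proj₁ (ends k) ≢ proj₂ (ends k)
    simple   : ∀ k l → SameEdge (ends k) (ends l) → k ≡ l

open Graph public

adjacency : (G : Graph) → Matrix (n G) (n G)
adjacency G i j = if ⌊ any? (λ k → sameEdge? (i , j) (ends G k)) ⌋ then 1ℚ else 0ℚ

incidence : (G : Graph) → Matrix (n G) (m G)
incidence G i k =
  if ⌊ i ≟ proj₁ (ends G k) ⌋ ∨ ⌊ i ≟ proj₂ (ends G k) ⌋ then 1ℚ else 0ℚ

_≅f_ : Graph → Graph → Set
G ≅f H = Σ (Matrix (n G) (n H)) λ S →
  DoublyStochastic S × ((adjacency G ⊗ S) ≐ (S ⊗ adjacency H))

_≡ₕ_ : Graph → Graph → Set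
G ≡ₕ H =
  (n G ≡ n H × m G ≡ 0 × m H ≡ 0)
  ⊎ (1 ≤ m G × 1 ≤ m H ×
     Σ (Matrix (n H) (n G)) λ S₁ → Σ (Matrix (m G) (m H)) λ S₂ →
       DoublyStochastic S₁ × DoublyStochastic S₂ ×
       ((S₁ ⊗ incidence G) ≐ (incidence H ⊗ transpose S₂)) ×
       ((incidence G ⊗ S₂) ≐ (transpose S₁ ⊗ incidence H)))

{-# OPTIONS --safe #-}
-- The incidence matrix M of a graph satisfies M Mᵀ = A + D, with A the adjacency
-- matrix and D the diagonal matrix of degrees. The two equations S₁ M = M′ S₂ᵀ and
-- M S₂ = S₁ᵀ M′ give (M Mᵀ) S₁ᵀ = S₁ᵀ (M′ M′ᵀ), and taking row sums against the
-- stochastic S₂ shows that each degree vector is the S₁-average of the other. For a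
-- doubly stochastic S₁ this forces the degrees to agree wherever S₁ is nonzero, that
-- is D S₁ᵀ = S₁ᵀ D′, and cancelling leaves A S₁ᵀ = S₁ᵀ A′. Without edges both
-- adjacency matrices vanish and the identity matrix does the job.
module Submission where

open import Defs
open import Data.Bool using (Bool; true; false; if_then_else_; _∨_)
open import Data.Fin using (Fin; zero; suc; _≟_)
open import Data.Fin.Properties using (any?; suc-injective; ¬Fin0)
import Data.Nat as ℕ
open import Data.Product using (_×_; _,_; proj₁; proj₂; Σ; ∃)
open import Data.Rational using (ℚ; 0ℚ; 1ℚ; _+_; _*_; _-_; _≤_)
open import Data.Rational.Base using (nonNegative; nonPositive)
open import Data.Rational.Properties
  using ( +-0-group; heytingCommutativeRing
        ; +-identityˡ; +-identityʳ; +-inverseʳ; +-mono-≤; +-monoˡ-≤; +-monoʳ-≤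
        ; *-comm; *-assoc; *-identityˡ; *-identityʳ; *-zeroˡ; *-zeroʳ
        ; *-distribˡ-+; *-distribʳ-+
        ; ≤-refl; ≤-antisym; ≤-total; nonNegative⁻¹
        ; nonNeg*nonNeg⇒nonNeg; nonPos*nonPos⇒nonPos )
  renaming (_≟_ to _≟ℚ_)
open import Algebra.Apartness.Properties.HeytingCommutativeRing heytingCommutativeRing
  using (x#0y#0→xy#0)
open import Algebra.Properties.Group +-0-group using (x∙y⁻¹≈ε⇒x≈y; ∙-cancelʳ)
open import Data.Rational.Solver using (module +-*-Solver)
open import Data.Sum using (inj₁; inj₂)
open import Function using (_∘_)
open import Relation.Binary.PropositionalEquality
open import Relation.Nullary using (Dec; yes; no; ¬_; contradiction)
open import Relation.Nullary.Decidable using (⌊_⌋)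
open import Relation.Unary using (Pred; Decidable)

open +-*-Solver using (solve; _:+_; _:*_; _:-_; _:=_)

indicator : Bool → ℚ
indicator b = if b then 1ℚ else 0ℚ

indicator-true : ∀ {p} {P : Set p} (P? : Dec P) → P → indicator ⌊ P? ⌋ ≡ 1ℚ
indicator-true (yes _) _ = refl
indicator-true (no ¬p) p = contradiction p ¬p

indicator-false : ∀ {p} {P : Set p} (P? : Dec P) → ¬ P → indicator ⌊ P? ⌋ ≡ 0ℚ
indicator-false (yes p) ¬p = contradiction p ¬p
indicator-false (no _) _ = refl

indicator-nonNeg : ∀ b → 0ℚ ≤ indicator b
indicator-nonNeg true = nonNegative⁻¹ 1ℚ
indicator-nonNeg false = ≤-refl

indicator-idem : ∀ b → indicator b * indicator b ≡ indicator b
indicator-idem true = refl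
indicator-idem false = refl

*-nonNeg : ∀ {p q} → 0ℚ ≤ p → 0ℚ ≤ q → 0ℚ ≤ p * q
*-nonNeg {p} {q} 0≤p 0≤q =
  nonNegative⁻¹ (p * q) {{nonNeg*nonNeg⇒nonNeg p {{nonNegative 0≤p}} q {{nonNegative 0≤q}}}}

square-nonNeg : ∀ p → 0ℚ ≤ p * p
square-nonNeg p with ≤-total 0ℚ p
... | inj₁ 0≤p = *-nonNeg 0≤p 0≤p
... | inj₂ p≤0 =
  -- despite its name, nonPos*nonPos⇒nonPos concludes NonNegative
  nonNegative⁻¹ (p * p) {{nonPos*nonPos⇒nonPos p {{nonPositive p≤0}} p {{nonPositive p≤0}}}}

nonNeg+nonNeg≡0⇒≡0 : ∀ {p q} → 0ℚ ≤ p → 0ℚ ≤ q → p + q ≡ 0ℚ → p ≡ 0ℚ × q ≡ 0ℚ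
nonNeg+nonNeg≡0⇒≡0 {p} {q} 0≤p 0≤q p+q≡0 = ≤-antisym p≤0 0≤p , ≤-antisym q≤0 0≤q
  where
  p≤0 : p ≤ 0ℚ
  p≤0 = subst₂ _≤_ (+-identityʳ p) p+q≡0 (+-monoʳ-≤ p 0≤q)
  q≤0 : q ≤ 0ℚ
  q≤0 = subst₂ _≤_ (+-identityˡ q) p+q≡0 (+-monoˡ-≤ q 0≤p)

weighted-square≡0 : ∀ s a b → s * ((a - b) * (a - b)) ≡ 0ℚ → a * s ≡ s * b
weighted-square≡0 s a b eq with a ≟ℚ b | s ≟ℚ 0ℚ
... | yes refl | _ = *-comm a s
... | no _ | yes refl = trans (*-zeroʳ a) (sym (*-zeroˡ b))
... | no a≢b | no s≢0 = contradiction eq (x#0y#0→xy#0 s≢0 (x#0y#0→xy#0 a-b≢0 a-b≢0))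
  where
  a-b≢0 : a - b ≢ 0ℚ
  a-b≢0 = a≢b ∘ x∙y⁻¹≈ε⇒x≈y a b

∑-cong : ∀ {k} {f g : Fin k → ℚ} → f ≗ g → ∑ k f ≡ ∑ k g
∑-cong {ℕ.zero} _ = refl
∑-cong {ℕ.suc k} f≗g = cong₂ _+_ (f≗g zero) (∑-cong (f≗g ∘ suc))

∑-zero : ∀ {k} {f : Fin k → ℚ} → (∀ i → f i ≡ 0ℚ) → ∑ k f ≡ 0ℚ
∑-zero {ℕ.zero} _ = refl
∑-zero {ℕ.suc k} f≡0 = cong₂ _+_ (f≡0 zero) (∑-zero (f≡0 ∘ suc))

∑-distrib-+ : ∀ {k} (f g : Fin k → ℚ) → ∑ k (λ i → f i + g i) ≡ ∑ k f + ∑ k g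
∑-distrib-+ {ℕ.zero} f g = refl
∑-distrib-+ {ℕ.suc k} f g =
  trans (cong (f zero + g zero +_) (∑-distrib-+ (f ∘ suc) (g ∘ suc)))
        (solve 4 (λ a b c d → (a :+ b) :+ (c :+ d) := (a :+ c) :+ (b :+ d)) refl
               (f zero) (g zero) (∑ k (f ∘ suc)) (∑ k (g ∘ suc)))

∑-distrib-sub : ∀ {k} (f g : Fin k → ℚ) → ∑ k (λ i → f i - g i) ≡ ∑ k f - ∑ k g
∑-distrib-sub {ℕ.zero} f g = refl
∑-distrib-sub {ℕ.suc k} f g =
  trans (cong (f zero - g zero +_) (∑-distrib-sub (f ∘ suc) (g ∘ suc)))
        (solve 4 (λ a b c d → (a :- b) :+ (c :- d) := (a :+ c) :- (b :+ d)) refl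
               (f zero) (g zero) (∑ k (f ∘ suc)) (∑ k (g ∘ suc)))

*-distribˡ-∑ : ∀ {k} c (f : Fin k → ℚ) → c * ∑ k f ≡ ∑ k (λ i → c * f i)
*-distribˡ-∑ {ℕ.zero} c f = *-zeroʳ c
*-distribˡ-∑ {ℕ.suc k} c f =
  trans (*-distribˡ-+ c (f zero) (∑ k (f ∘ suc)))
        (cong (c * f zero +_) (*-distribˡ-∑ c (f ∘ suc)))

*-distribʳ-∑ : ∀ {k} c (f : Fin k → ℚ) → ∑ k f * c ≡ ∑ k (λ i → f i * c)
*-distribʳ-∑ {ℕ.zero} c f = *-zeroˡ c
*-distribʳ-∑ {ℕ.suc k} c f =
  trans (*-distribʳ-+ c (f zero) (∑ k (f ∘ suc)))
        (cong (f zero * c +_) (*-distribʳ-∑ c (f ∘ suc)))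

∑-comm : ∀ {a b} (f : Fin a → Fin b → ℚ) →
         ∑ a (λ i → ∑ b (f i)) ≡ ∑ b (λ j → ∑ a (λ i → f i j))
∑-comm {ℕ.zero} {b} f = sym (∑-zero {b} (λ _ → refl))
∑-comm {ℕ.suc a} f =
  trans (cong (∑ _ (f zero) +_) (∑-comm (f ∘ suc)))
        (sym (∑-distrib-+ (f zero) (λ j → ∑ a (λ i → f (suc i) j))))

∑-single : ∀ {k} {f : Fin k → ℚ} i → (∀ l → i ≢ l → f l ≡ 0ℚ) → ∑ k f ≡ f i
∑-single {ℕ.suc k} {f} zero f≡0 =
  trans (cong (f zero +_) (∑-zero (λ l → f≡0 (suc l) (λ ())))) (+-identityʳ (f zero))
∑-single {ℕ.suc k} {f} (suc i) f≡0 =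
  trans (cong (_+ ∑ k (f ∘ suc)) (f≡0 zero (λ ())))
        (trans (+-identityˡ _) (∑-single i (λ l i≢l → f≡0 (suc l) (i≢l ∘ suc-injective))))

∑-indicator : ∀ {k p} {P : Pred (Fin k) p} (P? : Decidable P) →
              (∀ {a b} → P a → P b → a ≡ b) →
              ∑ k (λ l → indicator ⌊ P? l ⌋) ≡ indicator ⌊ any? P? ⌋
∑-indicator P? unique with any? P?
... | yes (i , Pi) = trans (∑-single i (λ l i≢l → indicator-false (P? l) (i≢l ∘ unique Pi)))
                           (indicator-true (P? i) Pi)
... | no ∄P = ∑-zero (λ l → indicator-false (P? l) (∄P ∘ (l ,_)))

∑-nonNeg : ∀ {k} {f : Fin k → ℚ} → (∀ i → 0ℚ ≤ f i) → 0ℚ ≤ ∑ k f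
∑-nonNeg {ℕ.zero} _ = ≤-refl
∑-nonNeg {ℕ.suc k} 0≤f = +-mono-≤ (0≤f zero) (∑-nonNeg (0≤f ∘ suc))

∑-nonNeg-≡0⇒≡0 : ∀ {k} {f : Fin k → ℚ} → (∀ i → 0ℚ ≤ f i) → ∑ k f ≡ 0ℚ → ∀ i → f i ≡ 0ℚ
∑-nonNeg-≡0⇒≡0 0≤f ∑≡0 zero =
  proj₁ (nonNeg+nonNeg≡0⇒≡0 (0≤f zero) (∑-nonNeg (0≤f ∘ suc)) ∑≡0)
∑-nonNeg-≡0⇒≡0 0≤f ∑≡0 (suc i) =
  ∑-nonNeg-≡0⇒≡0 (0≤f ∘ suc)
                 (proj₂ (nonNeg+nonNeg≡0⇒≡0 (0≤f zero) (∑-nonNeg (0≤f ∘ suc)) ∑≡0)) i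

_+ᴹ_ : ∀ {r c} → Matrix r c → Matrix r c → Matrix r c
(A +ᴹ B) i j = A i j + B i j

diag : ∀ {n} → (Fin n → ℚ) → Matrix n n
diag d i j = indicator ⌊ i ≟ j ⌋ * d i

1ᴹ : ∀ {n} → Matrix n n
1ᴹ i j = indicator ⌊ i ≟ j ⌋

rowSum : ∀ {r c} → Matrix r c → Fin r → ℚ
rowSum {c = c} A i = ∑ c (A i)

≐-from-diagonal : ∀ {n} {A B : Matrix n n} →
                  (∀ i → A i i ≡ B i i) → (∀ {i j} → i ≢ j → A i j ≡ B i j) → A ≐ B
≐-from-diagonal on off i j with i ≟ j
... | yes refl = on i
... | no i≢j = off i≢j

⊗-congˡ : ∀ {a b c} {A A′ : Matrix a b} (B : Matrix b c) → A ≐ A′ → (A ⊗ B) ≐ (A′ ⊗ B)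
⊗-congˡ B A≐A′ i j = ∑-cong (λ l → cong (_* B l j) (A≐A′ i l))

⊗-congʳ : ∀ {a b c} (A : Matrix a b) {B B′ : Matrix b c} → B ≐ B′ → (A ⊗ B) ≐ (A ⊗ B′)
⊗-congʳ A B≐B′ i j = ∑-cong (λ l → cong (A i l *_) (B≐B′ l j))

⊗-assoc : ∀ {a b c d} (A : Matrix a b) (B : Matrix b c) (C : Matrix c d) →
          ((A ⊗ B) ⊗ C) ≐ (A ⊗ (B ⊗ C))
⊗-assoc {b = b} {c} A B C i j = begin
  ∑ c (λ l → ∑ b (λ k → A i k * B k l) * C l j)
    ≡⟨ ∑-cong (λ l → *-distribʳ-∑ (C l j) (λ k → A i k * B k l)) ⟩
  ∑ c (λ l → ∑ b (λ k → A i k * B k l * C l j))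
    ≡⟨ ∑-comm (λ k l → A i k * B k l * C l j) ⟨
  ∑ b (λ k → ∑ c (λ l → A i k * B k l * C l j))
    ≡⟨ ∑-cong (λ k → ∑-cong (λ l → *-assoc (A i k) (B k l) (C l j))) ⟩
  ∑ b (λ k → ∑ c (λ l → A i k * (B k l * C l j)))
    ≡⟨ ∑-cong (λ k → *-distribˡ-∑ (A i k) (λ l → B k l * C l j)) ⟨
  ∑ b (λ k → A i k * ∑ c (λ l → B k l * C l j))
    ∎
  where open ≡-Reasoning

transpose-⊗ : ∀ {a b c} (A : Matrix a b) (B : Matrix b c) →
              transpose (A ⊗ B) ≐ (transpose B ⊗ transpose A)
transpose-⊗ A B i j = ∑-cong (λ l → *-comm (A j l) (B l i))

⊗-distribʳ-+ᴹ : ∀ {a b c} (A B : Matrix a b) (C : Matrix b c) →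
                ((A +ᴹ B) ⊗ C) ≐ ((A ⊗ C) +ᴹ (B ⊗ C))
⊗-distribʳ-+ᴹ A B C i j =
  trans (∑-cong (λ l → *-distribʳ-+ (C l j) (A i l) (B i l)))
        (∑-distrib-+ (λ l → A i l * C l j) (λ l → B i l * C l j))

⊗-distribˡ-+ᴹ : ∀ {a b c} (A : Matrix a b) (B C : Matrix b c) →
                (A ⊗ (B +ᴹ C)) ≐ ((A ⊗ B) +ᴹ (A ⊗ C))
⊗-distribˡ-+ᴹ A B C i j =
  trans (∑-cong (λ l → *-distribˡ-+ (A i l) (B l j) (C l j)))
        (∑-distrib-+ (λ l → A i l * B l j) (λ l → A i l * C l j))

diag-off : ∀ {n} (d : Fin n → ℚ) {i j} → i ≢ j → diag d i j ≡ 0ℚ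
diag-off d {i} {j} i≢j = trans (cong (_* d i) (indicator-false (i ≟ j) i≢j)) (*-zeroˡ (d i))

diag-on : ∀ {n} (d : Fin n → ℚ) i → diag d i i ≡ d i
diag-on d i = trans (cong (_* d i) (indicator-true (i ≟ i) refl)) (*-identityˡ (d i))

diag-⊗ : ∀ {n c} (d : Fin n → ℚ) (B : Matrix n c) i j → (diag d ⊗ B) i j ≡ d i * B i j
diag-⊗ d B i j =
  trans (∑-single i (λ l i≢l → trans (cong (_* B l j) (diag-off d i≢l)) (*-zeroˡ (B l j))))
        (cong (_* B i j) (diag-on d i))

⊗-diag : ∀ {r n} (A : Matrix r n) (d : Fin n → ℚ) i j → (A ⊗ diag d) i j ≡ A i j * d j
⊗-diag A d i j =
  trans (∑-single j (λ l j≢l → trans (cong (A i l *_) (diag-off d (j≢l ∘ sym)))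
                                     (*-zeroʳ (A i l))))
        (cong (A i j *_) (diag-on d j))

rowSum-⊗ : ∀ {a b c} (A : Matrix a b) (B : Matrix b c) i →
           rowSum (A ⊗ B) i ≡ ∑ b (λ l → A i l * rowSum B l)
rowSum-⊗ A B i =
  trans (∑-comm (λ k l → A i l * B l k)) (∑-cong (λ l → sym (*-distribˡ-∑ (A i l) (B l))))

rowSum-⊗-stochastic : ∀ {a b c} (A : Matrix a b) (B : Matrix b c) →
                      (∀ l → rowSum B l ≡ 1ℚ) → ∀ i → rowSum (A ⊗ B) i ≡ rowSum A i
rowSum-⊗-stochastic A B B-stochastic i =
  trans (rowSum-⊗ A B i)
        (∑-cong (λ l → trans (cong (A i l *_) (B-stochastic l)) (*-identityʳ (A i l))))

1ᴹ-doublyStochastic : ∀ {n} → DoublyStochastic (1ᴹ {n})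
1ᴹ-doublyStochastic =
  (λ i j → indicator-nonNeg ⌊ i ≟ j ⌋) ,
  (λ i → trans (∑-single i (λ l → indicator-false (i ≟ l))) (indicator-true (i ≟ i) refl)) ,
  (λ j → trans (∑-single j (λ l j≢l → indicator-false (l ≟ j) (j≢l ∘ sym)))
               (indicator-true (j ≟ j) refl))

transpose-doublyStochastic : ∀ {r c} {S : Matrix r c} →
                             DoublyStochastic S → DoublyStochastic (transpose S)
transpose-doublyStochastic (S≥0 , rows , columns) = (λ i j → S≥0 j i) , columns , rows

-- Mutual averaging makes the weighted variance ∑ S j i (x i − y j)² vanish.
mutual-averages-agree-on-support :
  ∀ {r c} {S : Matrix r c} → DoublyStochastic S →
  (x : Fin c → ℚ) (y : Fin r → ℚ) →
  (∀ i → x i ≡ ∑ r (λ j → S j i * y j)) → (∀ j → y j ≡ ∑ c (λ i → S j i * x i)) →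
  ∀ j i → x i * S j i ≡ S j i * y j
mutual-averages-agree-on-support {r} {c} {S} (S≥0 , rows , columns) x y x≡Sᵀy y≡Sx j i =
  weighted-square≡0 (S j i) (x i) (y j) (variance-term≡0 j i)
  where
  open ≡-Reasoning

  gap : Fin r → Fin c → ℚ
  gap j i = S j i * x i - S j i * y j

  column-balance : ∀ i → ∑ r (λ j → gap j i) ≡ 0ℚ
  column-balance i = begin
    ∑ r (λ j → gap j i)
      ≡⟨ ∑-distrib-sub (λ j → S j i * x i) (λ j → S j i * y j) ⟩
    ∑ r (λ j → S j i * x i) - ∑ r (λ j → S j i * y j)
      ≡⟨ cong₂ _-_ (*-distribʳ-∑ (x i) (λ j → S j i)) (x≡Sᵀy i) ⟨
    ∑ r (λ j → S j i) * x i - x i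
      ≡⟨ cong (λ s → s * x i - x i) (columns i) ⟩
    1ℚ * x i - x i
      ≡⟨ cong (_- x i) (*-identityˡ (x i)) ⟩
    x i - x i
      ≡⟨ +-inverseʳ (x i) ⟩
    0ℚ ∎

  row-balance : ∀ j → ∑ c (gap j) ≡ 0ℚ
  row-balance j = begin
    ∑ c (gap j)
      ≡⟨ ∑-distrib-sub (λ i → S j i * x i) (λ i → S j i * y j) ⟩
    ∑ c (λ i → S j i * x i) - ∑ c (λ i → S j i * y j)
      ≡⟨ cong₂ _-_ (y≡Sx j) (*-distribʳ-∑ (y j) (S j)) ⟨
    y j - ∑ c (S j) * y j
      ≡⟨ cong (λ s → y j - s * y j) (rows j) ⟩
    y j - 1ℚ * y j
      ≡⟨ cong (y j -_) (*-identityˡ (y j)) ⟩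
    y j - y j
      ≡⟨ +-inverseʳ (y j) ⟩
    0ℚ ∎

  term : Fin r → Fin c → ℚ
  term j i = S j i * ((x i - y j) * (x i - y j))

  term≥0 : ∀ j i → 0ℚ ≤ term j i
  term≥0 j i = *-nonNeg (S≥0 j i) (square-nonNeg (x i - y j))

  term-expand : ∀ j i → term j i ≡ x i * gap j i - y j * gap j i
  term-expand j i =
    solve 3 (λ s a b → s :* ((a :- b) :* (a :- b))
                       := a :* (s :* a :- s :* b) :- b :* (s :* a :- s :* b))
          refl (S j i) (x i) (y j)

  variance : ∑ r (λ j → ∑ c (term j)) ≡ 0ℚ
  variance = begin
    ∑ r (λ j → ∑ c (term j))
      ≡⟨ ∑-cong (λ j → trans (∑-cong (term-expand j))
                             (∑-distrib-sub (λ i → x i * gap j i) (λ i → y j * gap j i))) ⟩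
    ∑ r (λ j → ∑ c (λ i → x i * gap j i) - ∑ c (λ i → y j * gap j i))
      ≡⟨ ∑-distrib-sub (λ j → ∑ c (λ i → x i * gap j i))
                       (λ j → ∑ c (λ i → y j * gap j i)) ⟩
    ∑ r (λ j → ∑ c (λ i → x i * gap j i)) - ∑ r (λ j → ∑ c (λ i → y j * gap j i))
      ≡⟨ cong₂ _-_ (trans (∑-comm (λ j i → x i * gap j i))
                          (∑-zero (λ i → weighted-zero (x i) (λ j → gap j i) (column-balance i))))
                   (∑-zero (λ j → weighted-zero (y j) (gap j) (row-balance j))) ⟩
    0ℚ - 0ℚ
      ≡⟨ +-inverseʳ 0ℚ ⟩
    0ℚ ∎
    where
    weighted-zero : ∀ {k} w (f : Fin k → ℚ) → ∑ k f ≡ 0ℚ → ∑ k (λ l → w * f l) ≡ 0ℚ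
    weighted-zero w f ∑f≡0 =
      trans (sym (*-distribˡ-∑ w f)) (trans (cong (w *_) ∑f≡0) (*-zeroʳ w))

  variance-term≡0 : ∀ j i → term j i ≡ 0ℚ
  variance-term≡0 j =
    ∑-nonNeg-≡0⇒≡0 (term≥0 j) (∑-nonNeg-≡0⇒≡0 (λ j → ∑-nonNeg (term≥0 j)) variance j)

SameEdge-sym : ∀ {N} {p q : Fin N × Fin N} → SameEdge p q → SameEdge q p
SameEdge-sym (inj₁ (refl , refl)) = inj₁ (refl , refl)
SameEdge-sym (inj₂ (refl , refl)) = inj₂ (refl , refl)

SameEdge-trans : ∀ {N} {p q s : Fin N × Fin N} → SameEdge p q → SameEdge q s → SameEdge p s
SameEdge-trans (inj₁ (refl , refl)) q~s = q~s
SameEdge-trans (inj₂ (refl , refl)) (inj₁ (refl , refl)) = inj₂ (refl , refl)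
SameEdge-trans (inj₂ (refl , refl)) (inj₂ (refl , refl)) = inj₁ (refl , refl)

incidence-product : ∀ {N} {i l : Fin N} (e : Fin N × Fin N) → i ≢ l →
  indicator (⌊ i ≟ proj₁ e ⌋ ∨ ⌊ i ≟ proj₂ e ⌋) * indicator (⌊ l ≟ proj₁ e ⌋ ∨ ⌊ l ≟ proj₂ e ⌋)
    ≡ indicator ⌊ sameEdge? (i , l) e ⌋
incidence-product {i = i} {l} (a , b) i≢l with i ≟ a | i ≟ b | l ≟ a | l ≟ b
... | yes refl | _ | yes refl | _ = contradiction refl i≢l
... | _ | yes refl | _ | yes refl = contradiction refl i≢l
... | yes _ | yes _ | no  _ | no  _ = refl
... | yes _ | no  _ | no  _ | yes _ = refl
... | yes _ | no  _ | no  _ | no  _ = refl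
... | no  _ | yes _ | yes _ | no  _ = refl
... | no  _ | no  _ | yes _ | yes _ = refl
... | no  _ | no  _ | yes _ | no  _ = refl
... | no  _ | yes _ | no  _ | no  _ = refl
... | no  _ | no  _ | no  _ | yes _ = refl
... | no  _ | no  _ | no  _ | no  _ = refl

degree : (G : Graph) → Fin (n G) → ℚ
degree G = rowSum (incidence G)

adjacency-irreflexive : (G : Graph) → ∀ i → adjacency G i i ≡ 0ℚ
adjacency-irreflexive G i = indicator-false (any? (λ k → sameEdge? (i , i) (ends G k))) loop
  where
  loop : ¬ ∃ (λ k → SameEdge (i , i) (ends G k))
  loop (k , inj₁ (p , q)) = loopless G k (trans (sym p) q)
  loop (k , inj₂ (p , q)) = loopless G k (trans (sym q) p)

gram-diagonal : (G : Graph) → ∀ i → (incidence G ⊗ transpose (incidence G)) i i ≡ degree G i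
gram-diagonal G i = ∑-cong {m G} (λ k → indicator-idem _)

gram-offDiagonal : (G : Graph) → ∀ {i l} → i ≢ l →
                   (incidence G ⊗ transpose (incidence G)) i l ≡ adjacency G i l
gram-offDiagonal G {i} {l} i≢l =
  trans (∑-cong (λ k → incidence-product (ends G k) i≢l))
        (∑-indicator (λ k → sameEdge? (i , l) (ends G k))
                     (λ e≈k e≈k′ → simple G _ _ (SameEdge-trans (SameEdge-sym e≈k) e≈k′)))

incidence-gram : (G : Graph) →
                 (incidence G ⊗ transpose (incidence G)) ≐ (adjacency G +ᴹ diag (degree G))
incidence-gram G = ≐-from-diagonal on-diagonal off-diagonal
  where
  open ≡-Reasoning
  M = incidence G
  A = adjacency G
  D = diag (degree G)
  on-diagonal : ∀ i → (M ⊗ transpose M) i i ≡ A i i + D i i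
  on-diagonal i = begin
    (M ⊗ transpose M) i i  ≡⟨ gram-diagonal G i ⟩
    degree G i             ≡⟨ +-identityˡ (degree G i) ⟨
    0ℚ + degree G i        ≡⟨ cong₂ _+_ (adjacency-irreflexive G i) (diag-on (degree G) i) ⟨
    A i i + D i i          ∎
  off-diagonal : ∀ {i l} → i ≢ l → (M ⊗ transpose M) i l ≡ A i l + D i l
  off-diagonal {i} {l} i≢l = begin
    (M ⊗ transpose M) i l  ≡⟨ gram-offDiagonal G i≢l ⟩
    A i l                  ≡⟨ +-identityʳ (A i l) ⟨
    A i l + 0ℚ             ≡⟨ cong (A i l +_) (diag-off (degree G) i≢l) ⟨
    A i l + D i l          ∎

gram-intertwined : ∀ {a b c d} (M : Matrix a b) (N : Matrix c d) (S₁ : Matrix c a) (S₂ : Matrix b d) →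
                   (S₁ ⊗ M) ≐ (N ⊗ transpose S₂) → (M ⊗ S₂) ≐ (transpose S₁ ⊗ N) →
                   ((M ⊗ transpose M) ⊗ transpose S₁) ≐ (transpose S₁ ⊗ (N ⊗ transpose N))
gram-intertwined M N S₁ S₂ E₁ E₂ i j = begin
  ((M ⊗ transpose M) ⊗ transpose S₁) i j  ≡⟨ ⊗-assoc M (transpose M) (transpose S₁) i j ⟩
  (M ⊗ (transpose M ⊗ transpose S₁)) i j  ≡⟨ ⊗-congʳ M E₁ᵗ i j ⟩
  (M ⊗ (S₂ ⊗ transpose N)) i j            ≡⟨ ⊗-assoc M S₂ (transpose N) i j ⟨
  ((M ⊗ S₂) ⊗ transpose N) i j            ≡⟨ ⊗-congˡ (transpose N) E₂ i j ⟩
  ((transpose S₁ ⊗ N) ⊗ transpose N) i j  ≡⟨ ⊗-assoc (transpose S₁) N (transpose N) i j ⟩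
  (transpose S₁ ⊗ (N ⊗ transpose N)) i j  ∎
  where
  open ≡-Reasoning
  E₁ᵗ : (transpose M ⊗ transpose S₁) ≐ (S₂ ⊗ transpose N)
  E₁ᵗ k l =
    trans (sym (transpose-⊗ S₁ M k l)) (trans (E₁ l k) (transpose-⊗ N (transpose S₂) k l))

rowSum-reweight : ∀ {a b c d} {A : Matrix a b} {B : Matrix b c}
                  (C : Matrix a d) (D : Matrix d c) →
                  (∀ l → rowSum B l ≡ 1ℚ) → (A ⊗ B) ≐ (C ⊗ D) →
                  ∀ i → rowSum A i ≡ ∑ d (λ l → C i l * rowSum D l)
rowSum-reweight {A = A} {B} C D B-stochastic AB≐CD i = begin
  rowSum A i        ≡⟨ rowSum-⊗-stochastic A B B-stochastic i ⟨
  rowSum (A ⊗ B) i  ≡⟨ ∑-cong (AB≐CD i) ⟩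
  rowSum (C ⊗ D) i  ≡⟨ rowSum-⊗ C D i ⟩
  ∑ _ (λ l → C i l * rowSum D l) ∎
  where open ≡-Reasoning

adjacency-intertwined :
  (G H : Graph) {S₁ : Matrix (n H) (n G)} {S₂ : Matrix (m G) (m H)} →
  DoublyStochastic S₁ → DoublyStochastic S₂ →
  (S₁ ⊗ incidence G) ≐ (incidence H ⊗ transpose S₂) →
  (incidence G ⊗ S₂) ≐ (transpose S₁ ⊗ incidence H) →
  (adjacency G ⊗ transpose S₁) ≐ (transpose S₁ ⊗ adjacency H)
adjacency-intertwined G H {S₁} {S₂} S₁-ds (_ , rows₂ , columns₂) E₁ E₂ i j =
  ∙-cancelʳ (x i * T i j) ((A ⊗ T) i j) ((T ⊗ A′) i j) (begin
    (A ⊗ T) i j + x i * T i j          ≡⟨ cong ((A ⊗ T) i j +_) (diag-⊗ x T i j) ⟨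
    (A ⊗ T) i j + (diag x ⊗ T) i j     ≡⟨ ⊗-distribʳ-+ᴹ A (diag x) T i j ⟨
    ((A +ᴹ diag x) ⊗ T) i j            ≡⟨ ⊗-congˡ T (incidence-gram G) i j ⟨
    ((M ⊗ transpose M) ⊗ T) i j        ≡⟨ gram-intertwined M M′ S₁ S₂ E₁ E₂ i j ⟩
    (T ⊗ (M′ ⊗ transpose M′)) i j      ≡⟨ ⊗-congʳ T (incidence-gram H) i j ⟩
    (T ⊗ (A′ +ᴹ diag y)) i j           ≡⟨ ⊗-distribˡ-+ᴹ T A′ (diag y) i j ⟩
    (T ⊗ A′) i j + (T ⊗ diag y) i j    ≡⟨ cong ((T ⊗ A′) i j +_) (⊗-diag T y i j) ⟩
    (T ⊗ A′) i j + T i j * y j         ≡⟨ cong ((T ⊗ A′) i j +_) degrees-agree ⟨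
    (T ⊗ A′) i j + x i * T i j         ∎)
  where
  open ≡-Reasoning
  M = incidence G
  M′ = incidence H
  A = adjacency G
  A′ = adjacency H
  T = transpose S₁
  x = degree G
  y = degree H
  degrees-agree : x i * T i j ≡ T i j * y j
  degrees-agree =
    mutual-averages-agree-on-support S₁-ds x y
      (rowSum-reweight T M′ rows₂ E₂)
      (rowSum-reweight S₁ M columns₂ (λ k l → sym (E₁ k l)))
      j i

doublyStochastic-exists : ∀ {r c} → r ≡ c → Σ (Matrix r c) DoublyStochastic
doublyStochastic-exists refl = 1ᴹ , 1ᴹ-doublyStochastic

edgeless-adjacency : (G : Graph) → m G ≡ 0 → ∀ i l → adjacency G i l ≡ 0ℚ
edgeless-adjacency G m≡0 i l =
  indicator-false (any? (λ k → sameEdge? (i , l) (ends G k))) (¬Fin0 ∘ subst Fin m≡0 ∘ proj₁)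

zero-intertwined : ∀ {r c} {A : Matrix r r} {B : Matrix c c} (S : Matrix r c) →
                   (∀ i l → A i l ≡ 0ℚ) → (∀ i l → B i l ≡ 0ℚ) → (A ⊗ S) ≐ (S ⊗ B)
zero-intertwined S A≡0 B≡0 i j =
  trans (∑-zero (λ l → trans (cong (_* S l j) (A≡0 i l)) (*-zeroˡ (S l j))))
        (sym (∑-zero (λ l → trans (cong (S i l *_) (B≡0 l j)) (*-zeroʳ (S i l)))))

mainTheorem2 : (G H : Graph) → G ≡ₕ H → G ≅f H
mainTheorem2 G H (inj₁ (n≡n , edgeless-G , edgeless-H)) with doublyStochastic-exists n≡n
... | S , S-ds =
  S , S-ds , zero-intertwined S (edgeless-adjacency G edgeless-G) (edgeless-adjacency H edgeless-H)
mainTheorem2 G H (inj₂ (_ , _ , S₁ , S₂ , S₁-ds , S₂-ds , E₁ , E₂)) =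
  transpose S₁ , transpose-doublyStochastic S₁-ds ,
  adjacency-intertwined G H S₁-ds S₂-ds E₁ E₂
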